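{- Let $(U,V)$ be a word equation and $\sigma$ a solution with $\sigma(X)\ne\varepsilon$ for all variables $X$. Then $ab$ is crossing in $\sigma$ if and only if one of the following holds: (i) $aX$ or $\overline X\,\overline a$ occurs (as a factor) in $U$ or $V$ for a variable $X$, and $\sigma(X)$ begins with $b$ (so $\sigma(\overline X)$ ends with $\overline b$); (ii) $Xb$ or $\overline b\,\overline X$ occurs in $U$ or $V$ for a variable $X$, and $\sigma(X)$ ends with $a$ (so $\sigma(\overline X)$ begins with $\overline a$); (iii) $XY$ or $\overline Y\,\overline X$ occurs in $U$ or $V$ for variables $X,Y$, and $\sigma(X)$ ends with $a$ while $\sigma(Y)$ begins with $b$.
   Context: Constants come from a finite alphabet $B$ with involution $c\mapsto\overline c$ ($\overline{\overline c}=c$, extended to words by reversing and applying the involution letterwise); variables form a finite set with fixed-point-free involution. A word equation is a pair $(U,V)$ of words over constants and variables; a solution is a homomorphism $\sigma$ fixing constants, mapping variables to words over constants, with $\sigma(U)=\sigma(V)$ and $\sigma(\overline X)=\overline{\sigma(X)}$. For constants $a,b$ the $ab$-blocks are: if $a=b$, the words $a^i,\overline a^i$ ($i\ge2$); if $a\ne b$, $\overline a\ne a$, $\overline b\ne b$: $ab,\overline b\,\overline a$; if $a\ne b$, $\overline a=a$, $\overline b\ne b$: $ab,\overline ba,\overline bab$; if $a\ne b$, $\overline a\ne a$, $\overline b=b$: $ab, b\overline a, ab\overline a$; if $a\ne b$, $\overline a=a$, $\overline b=b$: $(ba)^i, a(ba)^i,(ba)^ib,(ab)^i$ ($i\ge1$).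 An $ab$-factor is an occurrence of an $ab$-block. An $ab$-factor of $\sigma(U)$ (resp. $\sigma(V)$) is crossing if it neither lies entirely within the part coming from constants of $U$ (resp. $V$) nor entirely within $\sigma(X)$ for a single occurrence of a variable $X$; $ab$ is crossing in $\sigma$ if some $ab$-factor is crossing. -}

module Defs where

open import Data.Nat using (ℕ; zero; suc; _≤_)
open import Data.Fin using (Fin)
open import Data.List using (List; []; _∷_; _++_; map; reverse; replicate; concat; _∷ʳ_)
open import Data.List.Relation.Unary.All using (All)
open import Data.Product using (Σ; ∃; ∃-syntax; _×_; _,_; proj₁; proj₂)
open import Data.Sum using (_⊎_)
open import Relation.Nullary using (¬_)
open import Relation.Binary.PropositionalEquality using (_≡_; _≢_; refl; cong; cong₂)
open import Data.List.Properties using (map-++)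

record ConstAlphabet : Set where
  field
    n         : ℕ
    bar       : Fin n → Fin n
    bar-invol : ∀ c → bar (bar c) ≡ c

record VarSet : Set where
  field
    m          : ℕ
    barV       : Fin m → Fin m
    barV-invol : ∀ x → barV (barV x) ≡ x
    barV-fpf   : ∀ x → barV x ≢ x

module _ (A : ConstAlphabet) (Vs : VarSet) where
  open ConstAlphabet A
  open VarSet Vs

  Const : Set
  Const = Fin n

  wbar : List Const → List Const
  wbar w = reverse (map bar w)

  data Sym : Set where
    const : Const → Sym
    var   : Fin m → Sym

  EqWord : Set
  EqWord = List Sym

  apply : (Fin m → List Const) → EqWord → List Const
  apply σ []            = []
  apply σ (const c ∷ W) = c ∷ apply σ W
  apply σ (var x ∷ W)   = σ x ++ apply σ W

  IsSolution : (Fin m → List Const) → EqWord → EqWord → Set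
  IsSolution σ U V = (∀ x → σ (barV x) ≡ wbar (σ x)) × apply σ U ≡ apply σ V

  -- origin of a letter of σ(W): from a constant of W, or from the
  -- occurrence of a variable at index k of W
  data Origin : Set where
    cst : Origin
    vr  : ℕ → Origin

  annot : (Fin m → List Const) → ℕ → EqWord → List (Const × Origin)
  annot σ k []            = []
  annot σ k (const c ∷ W) = (c , cst) ∷ annot σ (suc k) W
  annot σ k (var x ∷ W)   = map (λ c → c , vr k) (σ x) ++ annot σ (suc k) W

  annot-correct : ∀ σ k W → map proj₁ (annot σ k W) ≡ apply σ W
  annot-correct σ k []            = refl
  annot-correct σ k (const c ∷ W) = cong (c ∷_) (annot-correct σ (suc k) W)
  annot-correct σ k (var x ∷ W)   rewrite map-++ proj₁ (map (λ c → c , vr k) (σ x)) (annot σ (suc k) W)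
    = cong₂ _++_ (mapid (σ x)) (annot-correct σ (suc k) W)
    where
    mapid : ∀ w → map proj₁ (map (λ c → c , vr k) w) ≡ w
    mapid []      = refl
    mapid (c ∷ w) = cong (c ∷_) (mapid w)

  pow2 : ℕ → Const → Const → List Const
  pow2 i x y = concat (replicate i (x ∷ y ∷ []))

  data Block (a b : Const) : List Const → Set where
    eq₁ : a ≡ b → ∀ i → 2 ≤ i → Block a b (replicate i a)
    eq₂ : a ≡ b → ∀ i → 2 ≤ i → Block a b (replicate i (bar a))
    nn₁ : a ≢ b → bar a ≢ a → bar b ≢ b → Block a b (a ∷ b ∷ [])
    nn₂ : a ≢ b → bar a ≢ a → bar b ≢ b → Block a b (bar b ∷ bar a ∷ [])
    sn₁ : a ≢ b → bar a ≡ a → bar b ≢ b → Block a b (a ∷ b ∷ [])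
    sn₂ : a ≢ b → bar a ≡ a → bar b ≢ b → Block a b (bar b ∷ a ∷ [])
    sn₃ : a ≢ b → bar a ≡ a → bar b ≢ b → Block a b (bar b ∷ a ∷ b ∷ [])
    ns₁ : a ≢ b → bar a ≢ a → bar b ≡ b → Block a b (a ∷ b ∷ [])
    ns₂ : a ≢ b → bar a ≢ a → bar b ≡ b → Block a b (b ∷ bar a ∷ [])
    ns₃ : a ≢ b → bar a ≢ a → bar b ≡ b → Block a b (a ∷ b ∷ bar a ∷ [])
    ss₁ : a ≢ b → bar a ≡ a → bar b ≡ b → ∀ i → 1 ≤ i → Block a b (pow2 i b a)
    ss₂ : a ≢ b → bar a ≡ a → bar b ≡ b → ∀ i → 1 ≤ i → Block a b (a ∷ pow2 i b a)
    ss₃ : a ≢ b → bar a ≡ a → bar b ≡ b → ∀ i → 1 ≤ i → Block a b (pow2 i b a ++ b ∷ [])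
    ss₄ : a ≢ b → bar a ≡ a → bar b ≡ b → ∀ i → 1 ≤ i → Block a b (pow2 i a b)

  origins : List (Const × Origin) → List Origin
  origins = map proj₂

  -- a crossing ab-factor of σ(W): an occurrence f of an ab-block in σ(W)
  -- lying neither entirely within letters coming from constants of W
  -- nor entirely within σ(X) for a single occurrence of a variable X
  HasCrossingFactor : (Fin m → List Const) → EqWord → Const → Const → Set
  HasCrossingFactor σ W a b =
    ∃[ p ] ∃[ f ] ∃[ s ]
      ( annot σ 0 W ≡ p ++ f ++ s
      × Block a b (map proj₁ f)
      × ¬ All (_≡ cst) (origins f)
      × (∀ k → ¬ All (_≡ vr k) (origins f)) )

  Crossing : (Fin m → List Const) → EqWord → EqWord → Const → Const → Set
  Crossing σ U V a b = HasCrossingFactor σ U a b ⊎ HasCrossingFactor σ V a b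

  Factor2 : Sym → Sym → EqWord → Set
  Factor2 x y W = ∃[ p ] ∃[ s ] W ≡ p ++ x ∷ y ∷ s

  OccursIn : EqWord → EqWord → Sym → Sym → Set
  OccursIn U V x y = Factor2 x y U ⊎ Factor2 x y V

  BeginsWith : Const → List Const → Set
  BeginsWith c w = ∃[ w' ] w ≡ c ∷ w'

  EndsWith : Const → List Const → Set
  EndsWith c w = ∃[ w' ] w ≡ w' ∷ʳ c

  Cond₁ : (Fin m → List Const) → EqWord → EqWord → Const → Const → Set
  Cond₁ σ U V a b = ∃[ X ]
    ( (OccursIn U V (const a) (var X) ⊎ OccursIn U V (var (barV X)) (const (bar a)))
    × BeginsWith b (σ X) )

  Cond₂ : (Fin m → List Const) → EqWord → EqWord → Const → Const → Set
  Cond₂ σ U V a b = ∃[ X ]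
    ( (OccursIn U V (var X) (const b) ⊎ OccursIn U V (const (bar b)) (var (barV X)))
    × EndsWith a (σ X) )

  Cond₃ : (Fin m → List Const) → EqWord → EqWord → Const → Const → Set
  Cond₃ σ U V a b = ∃[ X ] ∃[ Y ]
    ( (OccursIn U V (var X) (var Y) ⊎ OccursIn U V (var (barV Y)) (var (barV X)))
    × EndsWith a (σ X) × BeginsWith b (σ Y) )

module Submission where

-- Annotate every letter of σ(W) with its origin: a constant of W, or the
-- occurrence of a variable at index k of W.  An ab-factor is crossing exactly
-- when two adjacent letters inside it have different origins.  Such a change of
-- origin happens only at a "seam": a factor z₁z₂ of W, not consisting of two
-- constants, where the image of z₁ ends with the left letter and the image of
-- z₂ begins with the right letter.  Consecutive letters of an ab-block always
-- read ab or b̄ā, and conversely both two-letter words are ab-blocks.  Hence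
--   ab is crossing  ⇔  W has a seam reading ab or b̄ā  (W = U or V).
-- A seam reading b̄ā is the same as a seam reading ab in the mirrored equation
-- (involution applied to both symbols and their order swapped), so crossing is
-- equivalent to a seam reading ab in U, V or their mirrors; unfolding this last
-- statement gives exactly the three conditions (i)-(iii).

open import Defs
open import Data.Fin using (Fin)
open import Data.List using (List; [])
open import Data.Sum using (_⊎_)
open import Function.Bundles using (_⇔_)
open import Relation.Binary.PropositionalEquality using (_≢_)

import Data.Fin as Fin
open import Data.Nat using (ℕ; zero; suc; z≤n; s≤s)
open import Data.Nat.Properties using () renaming (_≟_ to _≟ℕ_)
open import Data.List using (_∷_; _++_; map; reverse; replicate; _∷ʳ_)
open import Data.List.Properties
  using (++-assoc; map-++; map-id; map-∘; reverse-++; unfold-reverse; ∷-injective; ∷ʳ-injectiveʳ)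
open import Data.List.Relation.Unary.All using (All; []; _∷_; universal)
import Data.List.Relation.Unary.All.Properties as All
open import Data.List.Relation.Unary.Linked using (Linked; []; [-]; _∷_)
import Data.List.Relation.Unary.Linked.Properties as Linked
open import Data.Product using (∃; ∃₂; _×_; _,_; proj₁; proj₂)
open import Data.Sum using (inj₁; inj₂; swap) renaming (map to ⊎-map)
open import Data.Empty using (⊥-elim)
open import Function using (_∘_)
open import Function.Bundles using (mk⇔)
import Function.Properties.Equivalence as ⇔
open import Relation.Nullary using (¬_; yes; no)
open import Relation.Binary.Definitions using (DecidableEquality)
open import Relation.Binary.PropositionalEquality
  using (_≡_; refl; sym; trans; cong; cong₂; subst; subst₂; module ≡-Reasoning)

open ≡-Reasoning

module _ {X : Set} where

  Adjacent : X → X → List X → Set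
  Adjacent x y xs = ∃₂ λ p s → xs ≡ p ++ x ∷ y ∷ s

  adjacent-++ˡ : ∀ {x y xs} ys → Adjacent x y xs → Adjacent x y (xs ++ ys)
  adjacent-++ˡ {x} {y} ys (p , s , refl) = p , s ++ ys , ++-assoc p (x ∷ y ∷ s) ys

  adjacent-++ʳ : ∀ {x y} xs {ys} → Adjacent x y ys → Adjacent x y (xs ++ ys)
  adjacent-++ʳ xs (p , s , refl) = xs ++ p , s , sym (++-assoc xs p _)

  adjacent-infix : ∀ {x y xs} p {f} s → xs ≡ p ++ f ++ s → Adjacent x y f → Adjacent x y xs
  adjacent-infix p s refl adj = adjacent-++ʳ p (adjacent-++ˡ s adj)

  adjacent-join : ∀ {x y} p t → Adjacent x y ((p ∷ʳ x) ++ y ∷ t)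
  adjacent-join {x} {y} p t = p , t , ++-assoc p (x ∷ []) (y ∷ t)

  adjacent-split : ∀ xs {ys x y} → Adjacent x y (xs ++ ys) →
    Adjacent x y xs ⊎ Adjacent x y ys ⊎ ((∃ λ p → xs ≡ p ∷ʳ x) × (∃ λ t → ys ≡ y ∷ t))
  adjacent-split []           adj             = inj₂ (inj₁ adj)
  adjacent-split (z ∷ [])     ([] , s , refl) = inj₂ (inj₂ (([] , refl) , (s , refl)))
  adjacent-split (z ∷ w ∷ xs) ([] , s , refl) = inj₁ ([] , xs , refl)
  adjacent-split (z ∷ xs)     (q ∷ p , s , e) with refl , e′ ← ∷-injective e
    with adjacent-split xs (p , s , e′)
  ... | inj₁ adj                       = inj₁ (adjacent-++ʳ (z ∷ []) adj)
  ... | inj₂ (inj₁ adj)                = inj₂ (inj₁ adj)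
  ... | inj₂ (inj₂ ((p′ , e₁) , ends)) = inj₂ (inj₂ ((z ∷ p′ , cong (z ∷_) e₁) , ends))

  adjacent-All : ∀ {P : X → Set} {x y xs} → All P xs → Adjacent x y xs → P x × P y
  adjacent-All all (p , s , refl) with px ∷ py ∷ _ ← All.++⁻ʳ p all = px , py

  All-last : ∀ {P : X → Set} p {x} → All P (p ∷ʳ x) → P x
  All-last p all with px ∷ _ ← All.++⁻ʳ p all = px

  key-change : ∀ {K : Set} {R : X → X → Set} (key : X → K) → DecidableEquality K →
    ∀ {x xs} → Linked R (x ∷ xs) → (∀ k → ¬ All (λ y → key y ≡ k) (x ∷ xs)) →
    ∃₂ λ y z → Adjacent y z (x ∷ xs) × R y z × key y ≢ key z
  key-change key _≟_ {x} [-] nonconstant = ⊥-elim (nonconstant (key x) (refl ∷ []))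
  key-change key _≟_ {x} {y ∷ xs} (r ∷ linked) nonconstant with key x ≟ key y
  ... | no differ = x , y , ([] , xs , refl) , r , differ
  ... | yes same with key-change key _≟_ linked
                        (λ k → λ { (py ∷ all) → nonconstant k (trans same py ∷ py ∷ all) })
  ... | u , v , adj , r′ , differ′ = u , v , adjacent-++ʳ (x ∷ []) adj , r′ , differ′

module CrossingPairs (A : ConstAlphabet) (Vs : VarSet) where
  open ConstAlphabet A
  open VarSet Vs

  Letter : Set
  Letter = Const A Vs

  Symbol : Set
  Symbol = Sym A Vs

  Word : Set
  Word = EqWord A Vs

  Tagged : Set
  Tagged = Letter × Origin A Vs

  Subst : Set
  Subst = Fin m → List Letter

  -- the possible pairs of consecutive letters in an ab-block
  data Step (a b : Letter) : Letter → Letter → Set where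
    forward  : Step a b a b
    backward : Step a b (bar b) (bar a)

  linked-replicate : ∀ {R : Letter → Letter → Set} {x} → R x x → ∀ i → Linked R (replicate i x)
  linked-replicate r zero          = []
  linked-replicate r (suc zero)    = [-]
  linked-replicate r (suc (suc i)) = r ∷ linked-replicate r (suc i)

  linked-alternating : ∀ {R : Letter → Letter → Set} {x y} → R x y → R y x →
    ∀ i → Linked R (pow2 A Vs i x y)
  linked-alternating rxy ryx zero          = []
  linked-alternating rxy ryx (suc zero)    = rxy ∷ [-]
  linked-alternating rxy ryx (suc (suc i)) = rxy ∷ ryx ∷ linked-alternating rxy ryx (suc i)

  linked-alternating-end : ∀ {R : Letter → Letter → Set} {x y} → R x y → R y x →
    ∀ i → Linked R (pow2 A Vs i x y ++ x ∷ [])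
  linked-alternating-end rxy ryx zero          = [-]
  linked-alternating-end rxy ryx (suc zero)    = rxy ∷ ryx ∷ [-]
  linked-alternating-end rxy ryx (suc (suc i)) = rxy ∷ ryx ∷ linked-alternating-end rxy ryx (suc i)

  self-barred-step : ∀ {a b} → bar a ≡ a → bar b ≡ b → Step a b b a
  self-barred-step ā≡a b̄≡b = subst₂ (Step _ _) b̄≡b ā≡a backward

  block-steps : ∀ {a b w} → Block A Vs a b w → Linked (Step a b) w
  block-steps (eq₁ refl i _)           = linked-replicate forward i
  block-steps (eq₂ refl i _)           = linked-replicate backward i
  block-steps (nn₁ _ _ _)              = forward ∷ [-]
  block-steps (nn₂ _ _ _)              = backward ∷ [-]
  block-steps (sn₁ _ _ _)              = forward ∷ [-]
  block-steps (sn₂ _ ā≡a _)            = subst (Step _ _ _) ā≡a backward ∷ [-]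
  block-steps (sn₃ _ ā≡a _)            = subst (Step _ _ _) ā≡a backward ∷ forward ∷ [-]
  block-steps (ns₁ _ _ _)              = forward ∷ [-]
  block-steps (ns₂ _ _ b̄≡b)            = subst (λ c → Step _ _ c _) b̄≡b backward ∷ [-]
  block-steps (ns₃ _ _ b̄≡b)            = forward ∷ subst (λ c → Step _ _ c _) b̄≡b backward ∷ [-]
  block-steps (ss₁ _ ā≡a b̄≡b i _)      = linked-alternating (self-barred-step ā≡a b̄≡b) forward i
  block-steps (ss₂ _ ā≡a b̄≡b zero ())
  block-steps (ss₂ _ ā≡a b̄≡b (suc i) _) =
    forward ∷ linked-alternating (self-barred-step ā≡a b̄≡b) forward (suc i)
  block-steps (ss₃ _ ā≡a b̄≡b i _)      = linked-alternating-end (self-barred-step ā≡a b̄≡b) forward i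
  block-steps (ss₄ _ ā≡a b̄≡b i _)      = linked-alternating forward (self-barred-step ā≡a b̄≡b) i

  ab-block : ∀ a b → Block A Vs a b (a ∷ b ∷ [])
  ab-block a b with a Fin.≟ b
  ... | yes refl = eq₁ refl 2 (s≤s (s≤s z≤n))
  ... | no a≢b with bar a Fin.≟ a | bar b Fin.≟ b
  ... | no ā≢a  | no b̄≢b  = nn₁ a≢b ā≢a b̄≢b
  ... | yes ā≡a | no b̄≢b  = sn₁ a≢b ā≡a b̄≢b
  ... | no ā≢a  | yes b̄≡b = ns₁ a≢b ā≢a b̄≡b
  ... | yes ā≡a | yes b̄≡b = ss₄ a≢b ā≡a b̄≡b 1 (s≤s z≤n)

  mirrored-ab-block : ∀ a b → Block A Vs a b (bar b ∷ bar a ∷ [])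
  mirrored-ab-block a b with a Fin.≟ b
  ... | yes refl = eq₂ refl 2 (s≤s (s≤s z≤n))
  ... | no a≢b with bar a Fin.≟ a | bar b Fin.≟ b
  ... | no ā≢a  | no b̄≢b  = nn₂ a≢b ā≢a b̄≢b
  ... | yes ā≡a | no b̄≢b  rewrite ā≡a = sn₂ a≢b ā≡a b̄≢b
  ... | no ā≢a  | yes b̄≡b rewrite b̄≡b = ns₂ a≢b ā≢a b̄≡b
  ... | yes ā≡a | yes b̄≡b rewrite ā≡a | b̄≡b = ss₁ a≢b ā≡a b̄≡b 1 (s≤s z≤n)

  _≟ₒ_ : DecidableEquality (Origin A Vs)
  cst  ≟ₒ cst  = yes refl
  cst  ≟ₒ vr _ = no λ ()
  vr _ ≟ₒ cst  = no λ ()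
  vr k ≟ₒ vr j with k ≟ℕ j
  ... | yes refl = yes refl
  ... | no k≢j   = no λ { refl → k≢j refl }

  originOf : ℕ → Symbol → Origin A Vs
  originOf k (const _) = cst
  originOf k (var _)   = vr k

  data IsVar : Symbol → Set where
    is-var : ∀ X → IsVar (var X)

  distinct-origins⇒var : ∀ {k k′} z₁ z₂ → originOf k z₁ ≢ originOf k′ z₂ → IsVar z₁ ⊎ IsVar z₂
  distinct-origins⇒var (const _) (const _) differ = ⊥-elim (differ refl)
  distinct-origins⇒var (const _) (var Y)   _      = inj₂ (is-var Y)
  distinct-origins⇒var (var X)   _         _      = inj₁ (is-var X)

  var⇒distinct-origins : ∀ {k z₁ z₂} → IsVar z₁ ⊎ IsVar z₂ → originOf k z₁ ≢ originOf (suc k) z₂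
  var⇒distinct-origins {z₂ = const _} (inj₁ (is-var X)) ()
  var⇒distinct-origins {z₂ = var _}   (inj₁ (is-var X)) ()
  var⇒distinct-origins {z₁ = const _} (inj₂ (is-var Y)) ()
  var⇒distinct-origins {z₁ = var _}   (inj₂ (is-var Y)) ()

  Occurrence : Set₁
  Occurrence = Symbol → Symbol → Set

  InWord : Word → Occurrence
  InWord W z₁ z₂ = Factor2 A Vs z₁ z₂ W

  _∪_ : Occurrence → Occurrence → Occurrence
  (O ∪ O′) z₁ z₂ = O z₁ z₂ ⊎ O′ z₁ z₂

  barSym : Symbol → Symbol
  barSym (const c) = const (bar c)
  barSym (var X)   = var (barV X)

  barSym-invol : ∀ z → barSym (barSym z) ≡ z
  barSym-invol (const c) = cong const (bar-invol c)
  barSym-invol (var X)   = cong var (barV-invol X)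

  isVar-bar : ∀ {z} → IsVar z → IsVar (barSym z)
  isVar-bar (is-var X) = is-var (barV X)

  Mirror : Occurrence → Occurrence
  Mirror O z₁ z₂ = O (barSym z₂) (barSym z₁)

  BothWays : Occurrence → Occurrence
  BothWays O = O ∪ Mirror O

  module _ (σ : Subst) where

    data LastLetter : Symbol → Letter → Set where
      ends-const : ∀ {c} → LastLetter (const c) c
      ends-var   : ∀ {X c} → EndsWith A Vs c (σ X) → LastLetter (var X) c

    data FirstLetter : Symbol → Letter → Set where
      begins-const : ∀ {d} → FirstLetter (const d) d
      begins-var   : ∀ {X d} → BeginsWith A Vs d (σ X) → FirstLetter (var X) d

    record Seam (O : Occurrence) (c d : Letter) : Set where
      constructor seam
      field
        left right   : Symbol
        occurs       : O left right
        ends         : LastLetter left c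
        begins       : FirstLetter right d
        involves-var : IsVar left ⊎ IsVar right

    seam-map : ∀ {O O′ c d} → (∀ {z₁ z₂} → O z₁ z₂ → O′ z₁ z₂) → Seam O c d → Seam O′ c d
    seam-map f (seam z₁ z₂ occ l r v) = seam z₁ z₂ (f occ) l r v

    seam-split : ∀ {O O′ c d} → Seam (O ∪ O′) c d → Seam O c d ⊎ Seam O′ c d
    seam-split (seam z₁ z₂ (inj₁ occ) l r v) = inj₁ (seam z₁ z₂ occ l r v)
    seam-split (seam z₁ z₂ (inj₂ occ) l r v) = inj₂ (seam z₁ z₂ occ l r v)

    tag : ℕ → Letter → Tagged
    tag k c = c , vr k

    annotSym : ℕ → Symbol → List Tagged
    annotSym k (const c) = (c , cst) ∷ []
    annotSym k (var X)   = map (tag k) (σ X)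

    annot-∷ : ∀ k z W → annot A Vs σ k (z ∷ W) ≡ annotSym k z ++ annot A Vs σ (suc k) W
    annot-∷ k (const c) W = refl
    annot-∷ k (var X)   W = refl

    annotSym-origin : ∀ k z → All (λ x → proj₂ x ≡ originOf k z) (annotSym k z)
    annotSym-origin k (const c) = refl ∷ []
    annotSym-origin k (var X)   = All.map⁺ (universal (λ _ → refl) (σ X))

    untag : ∀ k w → w ≡ map proj₁ (map (tag k) w)
    untag k w = trans (sym (map-id w)) (map-∘ w)

    annotSym-last : ∀ k z {p x} → annotSym k z ≡ p ∷ʳ x → LastLetter z (proj₁ x)
    annotSym-last k (const c) {p} e with refl ← ∷ʳ-injectiveʳ [] p e = ends-const
    annotSym-last k (var X) {p} {x} e = ends-var (map proj₁ p , σX≡)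
      where
      σX≡ : σ X ≡ map proj₁ p ∷ʳ proj₁ x
      σX≡ = begin
        σ X                         ≡⟨ untag k (σ X) ⟩
        map proj₁ (map (tag k) (σ X)) ≡⟨ cong (map proj₁) e ⟩
        map proj₁ (p ∷ʳ x)          ≡⟨ map-++ proj₁ p (x ∷ []) ⟩
        map proj₁ p ∷ʳ proj₁ x      ∎

    annotSym-ending : ∀ k {z c} → LastLetter z c → ∃ λ q → annotSym k z ≡ q ∷ʳ (c , originOf k z)
    annotSym-ending k ends-const = [] , refl
    annotSym-ending k (ends-var {c = c} (w , σX≡)) rewrite σX≡ = map (tag k) w , map-++ (tag k) w (c ∷ [])

    annotSym-beginning : ∀ k {z d} → FirstLetter z d → ∃ λ t → annotSym k z ≡ (d , originOf k z) ∷ t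
    annotSym-beginning k begins-const = [] , refl
    annotSym-beginning k (begins-var (w , σX≡)) rewrite σX≡ = map (tag k) w , refl

    annot-head : (∀ X → σ X ≢ []) → ∀ k W {y t} → annot A Vs σ k W ≡ y ∷ t →
      ∃₂ λ z W′ → W ≡ z ∷ W′ × FirstLetter z (proj₁ y) × proj₂ y ≡ originOf k z
    annot-head nonempty k (const c ∷ W) refl = const c , W , refl , begins-const , refl
    annot-head nonempty k (var X ∷ W) e with σ X in σX≡
    ... | []     = ⊥-elim (nonempty X σX≡)
    ... | d ∷ ds with refl , _ ← ∷-injective e = var X , W , refl , begins-var (ds , σX≡) , refl

    seam-at-change : (∀ X → σ X ≢ []) → ∀ k W {x y} → Adjacent x y (annot A Vs σ k W) →
      proj₂ x ≢ proj₂ y → Seam (InWord W) (proj₁ x) (proj₁ y)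
    seam-at-change nonempty k [] ([] , _ , ())
    seam-at-change nonempty k [] (_ ∷ _ , _ , ())
    seam-at-change nonempty k (z ∷ W) {x} {y} adj differ
      with adjacent-split (annotSym k z) (subst (Adjacent x y) (annot-∷ k z W) adj)
    ... | inj₁ inside with ox , oy ← adjacent-All (annotSym-origin k z) inside =
      ⊥-elim (differ (trans ox (sym oy)))
    ... | inj₂ (inj₁ later) =
      seam-map (adjacent-++ʳ (z ∷ [])) (seam-at-change nonempty (suc k) W later differ)
    ... | inj₂ (inj₂ ((p , ends) , (t , begins)))
      with z₂ , W′ , refl , first , oy ← annot-head nonempty (suc k) W begins =
      seam z z₂ ([] , W′ , refl) (annotSym-last k z ends) first
        (distinct-origins⇒var z z₂ λ o → differ (trans ox (trans o (sym oy))))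
      where
      ox : proj₂ x ≡ originOf k z
      ox = All-last p (subst (All _) ends (annotSym-origin k z))

    seam⇒change : ∀ k W {c d} → Seam (InWord W) c d →
      ∃₂ λ o o′ → o ≢ o′ × Adjacent (c , o) (d , o′) (annot A Vs σ k W)
    seam⇒change k₀ _ {c} {d} (seam z₁ z₂ (p₀ , s , refl) l r v) = realise k₀ p₀
      where
      realise : ∀ k p → ∃₂ λ o o′ → o ≢ o′ × Adjacent (c , o) (d , o′) (annot A Vs σ k (p ++ z₁ ∷ z₂ ∷ s))
      realise k [] with q , eq ← annotSym-ending k l | t , et ← annotSym-beginning (suc k) r =
        originOf k z₁ , originOf (suc k) z₂ , var⇒distinct-origins v ,
        subst (Adjacent _ _) (sym σW≡) (adjacent-join q (t ++ rest))
        where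
        rest : List Tagged
        rest = annot A Vs σ (suc (suc k)) s

        σW≡ : annot A Vs σ k (z₁ ∷ z₂ ∷ s) ≡ (q ∷ʳ (c , originOf k z₁)) ++ ((d , originOf (suc k) z₂) ∷ t) ++ rest
        σW≡ = begin
          annot A Vs σ k (z₁ ∷ z₂ ∷ s)                  ≡⟨ annot-∷ k z₁ (z₂ ∷ s) ⟩
          annotSym k z₁ ++ annot A Vs σ (suc k) (z₂ ∷ s) ≡⟨ cong (annotSym k z₁ ++_) (annot-∷ (suc k) z₂ s) ⟩
          annotSym k z₁ ++ annotSym (suc k) z₂ ++ rest   ≡⟨ cong₂ (λ u w → u ++ w ++ rest) eq et ⟩
          (q ∷ʳ _) ++ (_ ∷ t) ++ rest                    ∎
      realise k (z ∷ p) with o , o′ , differ , adj ← realise (suc k) p =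
        o , o′ , differ , subst (Adjacent _ _) (sym (annot-∷ k z (p ++ z₁ ∷ z₂ ∷ s)))
                                 (adjacent-++ʳ (annotSym k z) adj)

    change⇒crossing-factor : ∀ W {a b x y} → Adjacent x y (annot A Vs σ 0 W) → proj₂ x ≢ proj₂ y →
      Block A Vs a b (proj₁ x ∷ proj₁ y ∷ []) → HasCrossingFactor A Vs σ W a b
    change⇒crossing-factor W {x = x} {y} (p , s , e) differ block =
      p , x ∷ y ∷ [] , s , e , block , mixed , λ _ → mixed
      where
      mixed : ∀ {o} → ¬ All (_≡ o) (proj₂ x ∷ proj₂ y ∷ [])
      mixed (ox ∷ oy ∷ []) = differ (trans ox (sym oy))

    seam⇒crossing-factor : ∀ W {a b c d} → Seam (InWord W) c d → Block A Vs a b (c ∷ d ∷ []) →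
      HasCrossingFactor A Vs σ W a b
    seam⇒crossing-factor W s block with o , o′ , differ , adj ← seam⇒change 0 W s =
      change⇒crossing-factor W adj differ block

    oriented : ∀ {O a b c d} → Step a b c d → Seam O c d → Seam O a b ⊎ Seam O (bar b) (bar a)
    oriented forward  = inj₁
    oriented backward = inj₂

    mixed-origins : ∀ {f : List Tagged} → ¬ All (_≡ cst) (origins A Vs f) →
      (∀ k → ¬ All (_≡ vr k) (origins A Vs f)) → ∀ o → ¬ All (λ x → proj₂ x ≡ o) f
    mixed-origins not-cst not-var cst    = not-cst ∘ All.map⁺
    mixed-origins not-cst not-var (vr k) = not-var k ∘ All.map⁺

    crossing-factor⇒seam : (∀ X → σ X ≢ []) → ∀ W {a b} → HasCrossingFactor A Vs σ W a b →
      Seam (InWord W) a b ⊎ Seam (InWord W) (bar b) (bar a)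
    crossing-factor⇒seam nonempty W (p , [] , s , e , block , not-cst , not-var) = ⊥-elim (not-cst [])
    crossing-factor⇒seam nonempty W (p , f@(_ ∷ _) , s , e , block , not-cst , not-var)
      with y , z , adj , step , differ ←
             key-change proj₂ _≟ₒ_ (Linked.map⁻ (block-steps block)) (mixed-origins not-cst not-var) =
      oriented step (seam-at-change nonempty 0 W (adjacent-infix p s e adj) differ)

    module Mirroring (σ-bar : ∀ X → σ (barV X) ≡ wbar A Vs (σ X)) where

      wbar-begins : ∀ {c w} → BeginsWith A Vs c w → EndsWith A Vs (bar c) (wbar A Vs w)
      wbar-begins {c} (w , refl) = reverse (map bar w) , unfold-reverse (bar c) (map bar w)

      wbar-ends : ∀ {c w} → EndsWith A Vs c w → BeginsWith A Vs (bar c) (wbar A Vs w)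
      wbar-ends {c} (w , refl) = reverse (map bar w) , (begin
        reverse (map bar (w ∷ʳ c))           ≡⟨ cong reverse (map-++ bar w (c ∷ [])) ⟩
        reverse (map bar w ∷ʳ bar c)         ≡⟨ reverse-++ (map bar w) (bar c ∷ []) ⟩
        bar c ∷ reverse (map bar w)          ∎)

      first⇒mirrored-last : ∀ {z c} → FirstLetter z c → LastLetter (barSym z) (bar c)
      first⇒mirrored-last begins-const = ends-const
      first⇒mirrored-last (begins-var {X} bw) =
        ends-var (subst (EndsWith A Vs _) (sym (σ-bar X)) (wbar-begins bw))

      last⇒mirrored-first : ∀ {z c} → LastLetter z c → FirstLetter (barSym z) (bar c)
      last⇒mirrored-first ends-const = begins-const
      last⇒mirrored-first (ends-var {X} ew) =
        begins-var (subst (BeginsWith A Vs _) (sym (σ-bar X)) (wbar-ends ew))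

      seam-unmirror : ∀ {O a b} → Seam (Mirror O) a b → Seam O (bar b) (bar a)
      seam-unmirror (seam z₁ z₂ occ l r v) =
        seam (barSym z₂) (barSym z₁) occ (first⇒mirrored-last r) (last⇒mirrored-first l)
             (swap (⊎-map isVar-bar isVar-bar v))

      seam-mirror : ∀ {O a b} → Seam O (bar b) (bar a) → Seam (Mirror O) a b
      seam-mirror {O} {a} {b} s =
        subst₂ (Seam (Mirror O)) (bar-invol a) (bar-invol b) (seam-unmirror (seam-map double-mirror s))
        where
        double-mirror : ∀ {z₁ z₂} → O z₁ z₂ → Mirror (Mirror O) z₁ z₂
        double-mirror = subst₂ O (sym (barSym-invol _)) (sym (barSym-invol _))

    Conditions : Word → Word → Letter → Letter → Set
    Conditions U V a b = Cond₁ A Vs σ U V a b ⊎ Cond₂ A Vs σ U V a b ⊎ Cond₃ A Vs σ U V a b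

    conditions⇔seam : ∀ U V a b → Conditions U V a b ⇔ Seam (BothWays (OccursIn A Vs U V)) a b
    conditions⇔seam U V a b = mk⇔ to from
      where
      to : Conditions U V a b → Seam (BothWays (OccursIn A Vs U V)) a b
      to (inj₁ (X , occ , bw))                 = seam _ _ occ ends-const (begins-var bw) (inj₂ (is-var X))
      to (inj₂ (inj₁ (X , occ , ew)))          = seam _ _ occ (ends-var ew) begins-const (inj₁ (is-var X))
      to (inj₂ (inj₂ (X , Y , occ , ew , bw))) = seam _ _ occ (ends-var ew) (begins-var bw) (inj₁ (is-var X))

      from : Seam (BothWays (OccursIn A Vs U V)) a b → Conditions U V a b
      from (seam _ _ occ ends-const        begins-const        (inj₁ ()))
      from (seam _ _ occ ends-const        begins-const        (inj₂ ()))
      from (seam _ _ occ ends-const        (begins-var {X} bw) _) = inj₁ (X , occ , bw)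
      from (seam _ _ occ (ends-var {X} ew) begins-const        _) = inj₂ (inj₁ (X , occ , ew))
      from (seam _ _ occ (ends-var {X} ew) (begins-var {Y} bw) _) = inj₂ (inj₂ (X , Y , occ , ew , bw))

    crossing⇔seam : (∀ X → σ (barV X) ≡ wbar A Vs (σ X)) → (∀ X → σ X ≢ []) → ∀ U V a b →
      Crossing A Vs σ U V a b ⇔ Seam (BothWays (OccursIn A Vs U V)) a b
    crossing⇔seam σ-bar nonempty U V a b = mk⇔ to from
      where
      open Mirroring σ-bar

      into-equation : ∀ {W} → (∀ {z₁ z₂} → InWord W z₁ z₂ → OccursIn A Vs U V z₁ z₂) →
        Seam (InWord W) a b ⊎ Seam (InWord W) (bar b) (bar a) → Seam (BothWays (OccursIn A Vs U V)) a b
      into-equation inW (inj₁ s) = seam-map (inj₁ ∘ inW) s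
      into-equation inW (inj₂ s) = seam-map inj₂ (seam-mirror (seam-map inW s))

      to : Crossing A Vs σ U V a b → Seam (BothWays (OccursIn A Vs U V)) a b
      to (inj₁ h) = into-equation inj₁ (crossing-factor⇒seam nonempty U h)
      to (inj₂ h) = into-equation inj₂ (crossing-factor⇒seam nonempty V h)

      crossing-at : ∀ {c d} → Seam (OccursIn A Vs U V) c d → Block A Vs a b (c ∷ d ∷ []) →
        Crossing A Vs σ U V a b
      crossing-at s block with seam-split s
      ... | inj₁ inU = inj₁ (seam⇒crossing-factor U inU block)
      ... | inj₂ inV = inj₂ (seam⇒crossing-factor V inV block)

      from : Seam (BothWays (OccursIn A Vs U V)) a b → Crossing A Vs σ U V a b
      from s with seam-split s
      ... | inj₁ direct   = crossing-at direct (ab-block a b)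
      ... | inj₂ mirrored = crossing-at (seam-unmirror mirrored) (mirrored-ab-block a b)

mainTheorem7 : (A : ConstAlphabet) (Vs : VarSet)
    (U V : EqWord A Vs) (σ : Fin (VarSet.m Vs) → List (Const A Vs)) →
    IsSolution A Vs σ U V →
    (∀ X → σ X ≢ []) →
    (a b : Const A Vs) →
    Crossing A Vs σ U V a b ⇔ (Cond₁ A Vs σ U V a b ⊎ Cond₂ A Vs σ U V a b ⊎ Cond₃ A Vs σ U V a b)
mainTheorem7 A Vs U V σ (σ-bar , _) nonempty a b =
  ⇔.trans (crossing⇔seam σ σ-bar nonempty U V a b) (⇔.sym (conditions⇔seam σ U V a b))
  where open CrossingPairs A Vs
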